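{- For every positive integer $n$, the set $\mathscr{C}_{F_{2k-1}}(n)$ of compositions of $n$ in which each part equal to $k$ comes in $F_{2k-1}$ colors is in one-to-one correspondence with the set of order-consecutive partition sequences of $[n]=\{1,\dots,n\}$.
   Context: $F_0=0$, $F_1=1$, $F_n=F_{n-1}+F_{n-2}$ are the Fibonacci numbers. A $w$-colored composition of $n$ (for a sequence $(w_k)$ of nonnegative integers) is a composition $(j_1,\dots,j_m)$ of $n$ together with a choice of one of $w_{j_i}$ colors for each part $j_i$; $\mathscr{C}_{w_k}(n)$ is the set of these. An ordered partition sequence of $[n]$ is a sequence $(S_1,\dots,S_p)$ ($p\ge1$) of pairwise disjoint nonempty sets whose union is $[n]$; it is order-consecutive if for every $k=1,\dots,p$ the union $S_1\cup\dots\cup S_k$ is a set of consecutive integers. -}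

module Defs where

open import Data.Nat using (ℕ; zero; suc; _+_; _*_; _∸_; _≤_)
open import Data.Fin using (Fin; toℕ)
import Data.Fin as F
open import Data.Product using (Σ; _×_; ∃)
open import Data.List using (List; []; _∷_; map; length; take)
open import Data.Nat.ListAction using (sum)
open import Data.List.Relation.Unary.All using (All)
open import Data.List.Relation.Unary.AllPairs using (AllPairs)
open import Data.Fin.Subset using (Subset; _∈_; _∩_; ⋃; ⊤; Nonempty; Empty)
open import Relation.Binary.PropositionalEquality using (_≡_)

fib : ℕ → ℕ
fib zero = 0
fib (suc zero) = 1
fib (suc (suc n)) = fib (suc n) + fib n

ColoredPart : (ℕ → ℕ) → Set
ColoredPart w = Σ ℕ (λ j → (1 ≤ j) × Fin (w j))

partSize : {w : ℕ → ℕ} → ColoredPart w → ℕ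
partSize (j Data.Product., _) = j

ColoredComposition : (ℕ → ℕ) → ℕ → Set
ColoredComposition w n = Σ (List (ColoredPart w)) (λ cs → sum (map partSize cs) ≡ n)

fibOddWeight : ℕ → ℕ
fibOddWeight k = fib (2 * k ∸ 1)

-- [n] is represented by Fin n (i.e. {0,…,n-1}); a subset of [n] is a Subset n.
-- A subset is a set of consecutive integers (an interval).
Consecutive : {n : ℕ} → Subset n → Set
Consecutive {n} S = (i j k : Fin n) → toℕ i ≤ toℕ j → toℕ j ≤ toℕ k → i ∈ S → k ∈ S → j ∈ S

IsOrderedPartitionSequence : {n : ℕ} → List (Subset n) → Set
IsOrderedPartitionSequence {n} Ss =
  (1 ≤ length Ss) × All Nonempty Ss × AllPairs (λ A B → Empty (A ∩ B)) Ss × (⋃ Ss ≡ ⊤)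

IsOrderConsecutivePartitionSequence : {n : ℕ} → List (Subset n) → Set
IsOrderConsecutivePartitionSequence Ss =
  IsOrderedPartitionSequence Ss ×
  ((k : ℕ) → 1 ≤ k → k ≤ length Ss → Consecutive (⋃ (take k Ss)))

-- An order-consecutive sequence (S₁,…,S_p) with p ≥ 2 is recovered from (S₁,…,S_{p-1}), which is
-- order-consecutive on the interval U = S₁ ∪ … ∪ S_{p-1}, together with the numbers a and r of points
-- of S_p = ∁ U to the left and to the right of U, where a + r ≥ 1. Unwinding this, the sequences
-- correspond to nestings: a first interval followed by steps (a , r). Cutting a nesting at its steps
-- with a = 0 splits it into blocks whose sizes form a composition of n, and the blocks of size k are
-- counted by F_{2k-1}: a block of size k + 1 either begins with a step (a , 0) or is a block of size k
-- widened by one point on the right, which gives the recursions F_{2k+1} = F_{2k} + F_{2k-1} and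
-- F_{2k} = F_{2k-1} + F_{2k-2}.
module Submission where

open import Defs
open import Data.Nat using (ℕ; zero; suc; _+_; _*_; _∸_; _≤_; z≤n; s≤s; s≤s⁻¹)
open import Data.Nat.Properties
  using (≤-refl; ≤-reflexive; ≤-trans; n≤1+n; m≤m+n; m≤n⇒m<n∨m≡n; +-suc; +-identityʳ; +-comm;
         *-suc; suc-injective; 0≢1+n; ≡-irrelevant)
open import Data.Nat.ListAction using (sum)
open import Data.Nat.Tactic.RingSolver using (solve-∀)
open import Data.Bool using (Bool; true; false; _∧_; _∨_; not)
open import Data.Fin using (Fin; zero; suc; toℕ; _↑ˡ_; _↑ʳ_; splitAt; join; cast)
open import Data.Fin.Properties using (splitAt-↑ˡ; splitAt-↑ʳ; join-splitAt; cast-involutive)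
open import Data.Vec as Vec using (Vec; []; _∷_; here; there; replicate; zipWith; _++_; toList)
open import Data.Vec.Properties
  using (zipWith-++; zipWith-replicate; map-++; map-replicate; ++-injectiveˡ; ++-injectiveʳ;
         lookup-++ˡ; lookup-++ʳ; lookup⇒[]=; []=⇒lookup; toList-++; toList-replicate; length-toList)
open import Data.Fin.Subset
  using (Subset; inside; outside; _∈_; _⊆_; _∩_; _∪_; ⋃; ⊤; ⊥; ∁; Nonempty; Empty)
open import Data.Fin.Subset.Properties
  using (∉⊥; ∈⊤; drop-there; drop-∷-Empty; drop-∷-⊆; Empty-unique; nonempty?; ∩-zeroʳ; ∪-identityʳ;
         ∪-identityˡ; ∪-assoc; p⊆p∪q; q⊆p∪q; x∈p∪q⁻; x∈p∩q⁻; x∈p∩q⁺)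
open import Data.Product using (Σ; _×_; _,_; ∃; proj₁; proj₂; map; map₁; map₂; uncurry)
open import Data.Sum using (inj₁; inj₂; [_,_]′)
open import Data.List as List using (List; []; _∷_; _∷ʳ_; length; take)
open import Data.List.Properties as Listₚ
  using (take-map; take-all; length-map; length-replicate; ++-cancelˡ; ++-cancelʳ; ∷ʳ-injective;
         ∷-injective; map-injective; map-∘; map-cong)
open import Data.List.Relation.Unary.All as All using (All; []; _∷_)
import Data.List.Relation.Unary.All.Properties as Allₚ
open import Data.List.Relation.Unary.AllPairs as AllPairs using (AllPairs; []; _∷_)
import Data.List.Relation.Unary.AllPairs.Properties as AllPairsₚ
open import Function using (_∘_)
open import Function.Definitions using (Injective)
open import Relation.Nullary using (yes; no; contradiction)
open import Relation.Binary.PropositionalEquality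
  using (_≡_; _≢_; refl; sym; trans; cong; cong₂; subst; module ≡-Reasoning)

private
  variable
    A B C : Set
    n : ℕ

pad : ∀ {c} (x : A) a r → Vec A c → Vec A (a + (c + r))
pad x a r xs = replicate a x ++ (xs ++ replicate r x)

zipWith-pad : ∀ (f : A → B → C) {c} x y a r (xs : Vec A c) (ys : Vec B c) →
  zipWith f (pad x a r xs) (pad y a r ys) ≡ pad (f x y) a r (zipWith f xs ys)
zipWith-pad f x y a r xs ys = begin
  zipWith f (pad x a r xs) (pad y a r ys)
    ≡⟨ zipWith-++ f (replicate a x) _ (replicate a y) _ ⟩
  zipWith f (replicate a x) (replicate a y) ++ zipWith f (xs ++ replicate r x) (ys ++ replicate r y)
    ≡⟨ cong₂ _++_ (zipWith-replicate f x y) (zipWith-++ f xs _ ys _) ⟩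
  replicate a (f x y) ++ (zipWith f xs ys ++ zipWith f (replicate r x) (replicate r y))
    ≡⟨ cong (λ zs → replicate a (f x y) ++ (zipWith f xs ys ++ zs)) (zipWith-replicate f x y) ⟩
  pad (f x y) a r (zipWith f xs ys) ∎
  where open ≡-Reasoning

map-pad : ∀ (f : A → B) {c} x a r (xs : Vec A c) →
  Vec.map f (pad x a r xs) ≡ pad (f x) a r (Vec.map f xs)
map-pad f x a r xs =
  trans (map-++ f (replicate a x) _)
    (cong₂ _++_ (map-replicate f x a) (trans (map-++ f xs _) (cong (Vec.map f xs ++_) (map-replicate f x r))))

pad-replicate : ∀ (x : A) a c r → pad x a r (replicate c x) ≡ replicate (a + (c + r)) x
pad-replicate x zero zero r = refl
pad-replicate x zero (suc c) r = cong (x ∷_) (pad-replicate x zero c r)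
pad-replicate x (suc a) c r = cong (x ∷_) (pad-replicate x a c r)

pad-injective : ∀ {c} (x : A) a r {xs ys : Vec A c} → pad x a r xs ≡ pad x a r ys → xs ≡ ys
pad-injective x a r eq = ++-injectiveˡ _ _ (++-injectiveʳ (replicate a x) (replicate a x) eq)

inset : ∀ {c} a r → Subset c → Subset (a + (c + r))
inset = pad outside

frame : ∀ a c r → Subset (a + (c + r))
frame a c r = pad inside a r ⊥

⊥-empty : ∀ {n} → Empty (⊥ {n})
⊥-empty (_ , i∈⊥) = ∉⊥ i∈⊥

∈-pad : ∀ {c} x a r {X : Subset c} {i} → i ∈ X → a ↑ʳ (i ↑ˡ r) ∈ pad x a r X
∈-pad x a r {X} {i} i∈X =
  lookup⇒[]= _ _ (trans (lookup-++ʳ (replicate a x) _ (i ↑ˡ r))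
                        (trans (lookup-++ˡ X _ i) ([]=⇒lookup i∈X)))

inset-⊥ : ∀ a c r → inset a r (⊥ {c}) ≡ ⊥
inset-⊥ = pad-replicate outside

inset-∩ : ∀ {c} a r (X Y : Subset c) → inset a r X ∩ inset a r Y ≡ inset a r (X ∩ Y)
inset-∩ = zipWith-pad _∧_ outside outside

inset-∪ : ∀ {c} a r (X Y : Subset c) → inset a r X ∪ inset a r Y ≡ inset a r (X ∪ Y)
inset-∪ = zipWith-pad _∨_ outside outside

inset-nonempty⁺ : ∀ {c} a r {X : Subset c} → Nonempty X → Nonempty (inset a r X)
inset-nonempty⁺ a r (i , i∈X) = _ , ∈-pad outside a r i∈X

inset-nonempty⁻ : ∀ {c} a r {X : Subset c} → Nonempty (inset a r X) → Nonempty X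
inset-nonempty⁻ {c} a r {X} ne with nonempty? X
... | yes X≢∅ = X≢∅
... | no X≡∅ =
  contradiction (subst Nonempty (trans (cong (inset a r) (Empty-unique X≡∅)) (inset-⊥ a c r)) ne) ⊥-empty

inset-empty⁺ : ∀ {c} a r {X : Subset c} → Empty X → Empty (inset a r X)
inset-empty⁺ a r X≡∅ ne = X≡∅ (inset-nonempty⁻ a r ne)

inset-empty⁻ : ∀ {c} a r {X : Subset c} → Empty (inset a r X) → Empty X
inset-empty⁻ a r X≡∅ ne = X≡∅ (inset-nonempty⁺ a r ne)

inset-∩-frame : ∀ {c} a r (X : Subset c) → inset a r X ∩ frame a c r ≡ ⊥
inset-∩-frame {c} a r X = begin
  inset a r X ∩ frame a c r ≡⟨ zipWith-pad _∧_ outside inside a r X ⊥ ⟩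
  inset a r (X ∩ ⊥)         ≡⟨ cong (inset a r) (∩-zeroʳ X) ⟩
  inset a r ⊥               ≡⟨ inset-⊥ a c r ⟩
  ⊥                         ∎
  where open ≡-Reasoning

inset-∪-frame : ∀ {c} a r (X : Subset c) → inset a r X ∪ frame a c r ≡ pad inside a r X
inset-∪-frame a r X = trans (zipWith-pad _∨_ outside inside a r X ⊥) (cong (pad inside a r) (∪-identityʳ X))

∁-inset-⊤ : ∀ a c r → ∁ (inset a r ⊤) ≡ frame a c r
∁-inset-⊤ a c r = trans (map-pad not outside a r ⊤) (cong (pad inside a r) (map-replicate not inside c))

frame-nonempty⁺ : ∀ a c r → 1 ≤ a + r → Nonempty (frame a c r)
frame-nonempty⁺ (suc a) c r _ = zero , here
frame-nonempty⁺ zero c (suc r) _ = c ↑ʳ zero , lookup⇒[]= _ _ (lookup-++ʳ (replicate c outside) _ zero)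

frame-nonempty⁻ : ∀ a c r → Nonempty (frame a c r) → 1 ≤ a + r
frame-nonempty⁻ (suc a) c r _ = s≤s z≤n
frame-nonempty⁻ zero c (suc r) _ = s≤s z≤n
frame-nonempty⁻ zero c zero ne = contradiction (subst Nonempty (inset-⊥ 0 c 0) ne) ⊥-empty

∁-unique : ∀ {n} {p q : Subset n} → p ∪ q ≡ ⊤ → Empty (p ∩ q) → q ≡ ∁ p
∁-unique {p = []}          {[]}          _      _      = refl
∁-unique {p = inside ∷ p}  {inside ∷ q}  _      p∩q≡∅ = contradiction (zero , here) p∩q≡∅
∁-unique {p = outside ∷ p} {outside ∷ q} ()     _
∁-unique {p = inside ∷ p}  {outside ∷ q} p∪q≡⊤ p∩q≡∅ =
  cong (outside ∷_) (∁-unique (cong Vec.tail p∪q≡⊤) (drop-∷-Empty p∩q≡∅))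
∁-unique {p = outside ∷ p} {inside ∷ q}  p∪q≡⊤ p∩q≡∅ =
  cong (inside ∷_) (∁-unique (cong Vec.tail p∪q≡⊤) (drop-∷-Empty p∩q≡∅))

⊆-inset-⊤ : ∀ {c} a r {T : Subset (a + (c + r))} → T ⊆ inset a r ⊤ →
  ∃ λ T′ → inset a r T′ ≡ T
⊆-inset-⊤         (suc a) r {inside ∷ T}  T⊆ = contradiction (T⊆ here) λ ()
⊆-inset-⊤         (suc a) r {outside ∷ T} T⊆ =
  map₂ (cong (outside ∷_)) (⊆-inset-⊤ a r (drop-∷-⊆ T⊆))
⊆-inset-⊤ {zero}  zero    r               T⊆ = [] , sym (Empty-unique λ (_ , i∈T) → ∉⊥ (T⊆ i∈T))
⊆-inset-⊤ {suc c} zero    r {x ∷ T}       T⊆ =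
  map (x ∷_) (cong (x ∷_)) (⊆-inset-⊤ {c} zero r (drop-∷-⊆ T⊆))

-- Consecutive subsets

-- Consecutiveness is characterised by a Boolean test, so that its invariance under inset becomes a computation.
allOutside : ∀ {n} → Subset n → Bool
allOutside []            = true
allOutside (inside ∷ _)  = false
allOutside (outside ∷ p) = allOutside p

isInitial : ∀ {n} → Subset n → Bool
isInitial []            = true
isInitial (inside ∷ p)  = isInitial p
isInitial (outside ∷ p) = allOutside p

isInterval : ∀ {n} → Subset n → Bool
isInterval []            = true
isInterval (inside ∷ p)  = isInitial p
isInterval (outside ∷ p) = isInterval p

allOutside⇒≡⊥ : ∀ {n} {p : Subset n} → allOutside p ≡ true → p ≡ ⊥
allOutside⇒≡⊥ {p = []}          _ = refl
allOutside⇒≡⊥ {p = inside ∷ p}  ()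
allOutside⇒≡⊥ {p = outside ∷ p} h = cong (outside ∷_) (allOutside⇒≡⊥ h)

Empty⇒allOutside : ∀ {n} {p : Subset n} → Empty p → allOutside p ≡ true
Empty⇒allOutside {p = []}          _ = refl
Empty⇒allOutside {p = inside ∷ p}  p≡∅ = contradiction (zero , here) p≡∅
Empty⇒allOutside {p = outside ∷ p} p≡∅ = Empty⇒allOutside λ (i , i∈p) → p≡∅ (suc i , there i∈p)

Consecutive-tail : ∀ {n x} {p : Subset n} → Consecutive (x ∷ p) → Consecutive p
Consecutive-tail h i j k i≤j j≤k i∈p k∈p =
  drop-there (h (suc i) (suc j) (suc k) (s≤s i≤j) (s≤s j≤k) (there i∈p) (there k∈p))

isInitial⇒downClosed : ∀ {n} {p : Subset n} → isInitial p ≡ true →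
  (j k : Fin (suc n)) → toℕ j ≤ toℕ k → k ∈ inside ∷ p → j ∈ inside ∷ p
isInitial⇒downClosed                    h zero    k       _         _              = here
isInitial⇒downClosed {p = inside ∷ p}  h (suc j) (suc k) (s≤s j≤k) (there k∈p)    =
  there (isInitial⇒downClosed h j k j≤k k∈p)
isInitial⇒downClosed {p = outside ∷ p} h (suc j) (suc k) _         (there (there k∈p)) =
  contradiction (subst (_ ∈_) (allOutside⇒≡⊥ h) k∈p) ∉⊥

isInterval⇒Consecutive : ∀ {n} {p : Subset n} → isInterval p ≡ true → Consecutive p
isInterval⇒Consecutive {p = inside ∷ p}  h _ j k _ j≤k _ k∈p = isInitial⇒downClosed h j k j≤k k∈p
isInterval⇒Consecutive {p = outside ∷ p} h
  (suc i) (suc j) (suc k) (s≤s i≤j) (s≤s j≤k) (there i∈p) (there k∈p) =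
  there (isInterval⇒Consecutive h i j k i≤j j≤k i∈p k∈p)

Consecutive⇒isInitial : ∀ {n} {p : Subset n} → Consecutive (inside ∷ p) → isInitial p ≡ true
Consecutive⇒isInitial {p = []}          _ = refl
Consecutive⇒isInitial {p = inside ∷ p}  h = Consecutive⇒isInitial (Consecutive-tail h)
Consecutive⇒isInitial {p = outside ∷ p} h = Empty⇒allOutside λ (i , i∈p) →
  contradiction (h zero (suc zero) (suc (suc i)) z≤n (s≤s z≤n) here (there (there i∈p))) λ { (there ()) }

Consecutive⇒isInterval : ∀ {n} {p : Subset n} → Consecutive p → isInterval p ≡ true
Consecutive⇒isInterval {p = []}          _ = refl
Consecutive⇒isInterval {p = inside ∷ p}  h = Consecutive⇒isInitial h
Consecutive⇒isInterval {p = outside ∷ p} h = Consecutive⇒isInterval (Consecutive-tail h)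

allOutside-++-⊥ : ∀ {c} (p : Subset c) r → allOutside (p ++ ⊥ {r}) ≡ allOutside p
allOutside-++-⊥ [] zero = refl
allOutside-++-⊥ [] (suc r) = allOutside-++-⊥ [] r
allOutside-++-⊥ (inside ∷ p) r = refl
allOutside-++-⊥ (outside ∷ p) r = allOutside-++-⊥ p r

isInitial-++-⊥ : ∀ {c} (p : Subset c) r → isInitial (p ++ ⊥ {r}) ≡ isInitial p
isInitial-++-⊥ [] zero = refl
isInitial-++-⊥ [] (suc r) = allOutside-++-⊥ [] r
isInitial-++-⊥ (inside ∷ p) r = isInitial-++-⊥ p r
isInitial-++-⊥ (outside ∷ p) r = allOutside-++-⊥ p r

isInterval-++-⊥ : ∀ {c} (p : Subset c) r → isInterval (p ++ ⊥ {r}) ≡ isInterval p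
isInterval-++-⊥ [] zero = refl
isInterval-++-⊥ [] (suc r) = isInterval-++-⊥ [] r
isInterval-++-⊥ (inside ∷ p) r = isInitial-++-⊥ p r
isInterval-++-⊥ (outside ∷ p) r = isInterval-++-⊥ p r

isInterval-inset : ∀ {c} a r (p : Subset c) → isInterval (inset a r p) ≡ isInterval p
isInterval-inset zero r p = isInterval-++-⊥ p r
isInterval-inset (suc a) r p = isInterval-inset a r p

Consecutive-inset⁺ : ∀ {c} a r {p : Subset c} → Consecutive p → Consecutive (inset a r p)
Consecutive-inset⁺ a r {p} h =
  isInterval⇒Consecutive (trans (isInterval-inset a r p) (Consecutive⇒isInterval h))

Consecutive-inset⁻ : ∀ {c} a r {p : Subset c} → Consecutive (inset a r p) → Consecutive p
Consecutive-inset⁻ a r {p} h =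
  isInterval⇒Consecutive (trans (sym (isInterval-inset a r p)) (Consecutive⇒isInterval h))

Consecutive-⊤ : ∀ {n} → Consecutive (⊤ {n})
Consecutive-⊤ _ _ _ _ _ _ _ = ∈⊤

record IntervalForm {n} (U : Subset n) : Set where
  constructor intervalForm
  field
    left width right : ℕ
    size≡ : left + (width + right) ≡ n
    form : subst Subset size≡ (inset left right ⊤) ≡ U

isInitial⇒IntervalForm : ∀ {n} {p : Subset n} → isInitial p ≡ true → IntervalForm (inside ∷ p)
isInitial⇒IntervalForm {p = p} h with initialSegment {p = p} h
  where
  initialSegment : ∀ {n} {p : Subset n} → isInitial p ≡ true →
    Σ ℕ λ c → Σ ℕ λ r → Σ (c + r ≡ n) λ e → subst Subset e (⊤ {c} ++ ⊥ {r}) ≡ p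
  initialSegment {p = []} _ = 0 , 0 , refl , refl
  initialSegment {p = inside ∷ p} h with initialSegment {p = p} h
  ... | c , r , refl , refl = suc c , r , refl , refl
  initialSegment {suc n} {p = outside ∷ p} h = 0 , suc n , refl , cong (outside ∷_) (sym (allOutside⇒≡⊥ h))
... | c , r , refl , refl = intervalForm 0 (suc c) r refl refl

Consecutive⇒IntervalForm : ∀ {n} {U : Subset n} → Consecutive U → Nonempty U → IntervalForm U
Consecutive⇒IntervalForm {U = inside ∷ U} h _ = isInitial⇒IntervalForm (Consecutive⇒isInitial h)
Consecutive⇒IntervalForm {U = outside ∷ U} h (suc i , there i∈U)
  with Consecutive⇒IntervalForm (Consecutive-tail h) (i , i∈U)
... | intervalForm a c r refl refl = intervalForm (suc a) c r refl refl

-- Extending a partition sequence by a frame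

length-∷ʳ : ∀ (xs : List A) x → length (xs ∷ʳ x) ≡ suc (length xs)
length-∷ʳ []       x = refl
length-∷ʳ (_ ∷ xs) x = cong suc (length-∷ʳ xs x)

take-++ˡ : ∀ k (xs ys : List A) → k ≤ length xs → take k (xs List.++ ys) ≡ take k xs
take-++ˡ zero    xs       ys _         = refl
take-++ˡ (suc k) (x ∷ xs) ys (s≤s k≤l) = cong (x ∷_) (take-++ˡ k xs ys k≤l)

AllPairs-∷ʳ⁺ : ∀ {R : A → A → Set} {xs x} →
  AllPairs R xs → All (λ y → R y x) xs → AllPairs R (xs ∷ʳ x)
AllPairs-∷ʳ⁺ Rxs Rx = AllPairsₚ.++⁺ Rxs ([] ∷ []) (All.map (_∷ []) Rx)

AllPairs-∷ʳ⁻ : ∀ {R : A → A → Set} xs {x} →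
  AllPairs R (xs ∷ʳ x) → AllPairs R xs × All (λ y → R y x) xs
AllPairs-∷ʳ⁻ []       _           = [] , []
AllPairs-∷ʳ⁻ (_ ∷ xs) (Ry ∷ Rxs) with Allₚ.∷ʳ⁻ Ry | AllPairs-∷ʳ⁻ xs Rxs
... | Ryxs , Ryx | Rxs′ , Rxsx = Ryxs ∷ Rxs′ , Ryx ∷ Rxsx

⋃-∷ʳ : ∀ (Ts : List (Subset n)) L → ⋃ (Ts ∷ʳ L) ≡ ⋃ Ts ∪ L
⋃-∷ʳ []       L = trans (∪-identityʳ L) (sym (∪-identityˡ L))
⋃-∷ʳ (T ∷ Ts) L = trans (cong (T ∪_) (⋃-∷ʳ Ts L)) (sym (∪-assoc T (⋃ Ts) L))

⊆-⋃ : (Ts : List (Subset n)) → All (_⊆ ⋃ Ts) Ts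
⊆-⋃ []       = []
⊆-⋃ (T ∷ Ts) = p⊆p∪q (⋃ Ts) ∷ All.map (λ T⊆ {i} i∈ → q⊆p∪q T (⋃ Ts) (T⊆ i∈)) (⊆-⋃ Ts)

⋃-disjoint : ∀ (Ts : List (Subset n)) {L} → All (λ T → Empty (T ∩ L)) Ts → Empty (⋃ Ts ∩ L)
⋃-disjoint []       _              (_ , i∈⊥∩L) = ⊥-empty (_ , proj₁ (x∈p∩q⁻ ⊥ _ i∈⊥∩L))
⋃-disjoint (T ∷ Ts) (T∩L≡∅ ∷ rest) (i , i∈∩) with x∈p∩q⁻ (T ∪ ⋃ Ts) _ i∈∩
... | i∈∪ , i∈L with x∈p∪q⁻ T (⋃ Ts) i∈∪
...   | inj₁ i∈T  = T∩L≡∅ (i , x∈p∩q⁺ (i∈T , i∈L))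
...   | inj₂ i∈Ts = ⋃-disjoint Ts rest (i , x∈p∩q⁺ (i∈Ts , i∈L))

⋃-map-inset : ∀ {c} a r (Ts : List (Subset c)) → ⋃ (List.map (inset a r) Ts) ≡ inset a r (⋃ Ts)
⋃-map-inset {c} a r []       = sym (inset-⊥ a c r)
⋃-map-inset     a r (T ∷ Ts) = trans (cong (inset a r T ∪_) (⋃-map-inset a r Ts)) (inset-∪ a r T (⋃ Ts))

PrefixesConsecutive : List (Subset n) → Set
PrefixesConsecutive Ss = (k : ℕ) → 1 ≤ k → k ≤ length Ss → Consecutive (⋃ (take k Ss))

PrefixesConsecutive-∷ʳ⁺ : ∀ {Ts : List (Subset n)} {L} →
  PrefixesConsecutive Ts → Consecutive (⋃ (Ts ∷ʳ L)) → PrefixesConsecutive (Ts ∷ʳ L)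
PrefixesConsecutive-∷ʳ⁺ {Ts = Ts} {L} pc cons k 1≤k k≤
  with m≤n⇒m<n∨m≡n (subst (k ≤_) (length-∷ʳ Ts L) k≤)
... | inj₁ k<   =
  subst (Consecutive ∘ ⋃) (sym (take-++ˡ k Ts (L ∷ []) (s≤s⁻¹ k<))) (pc k 1≤k (s≤s⁻¹ k<))
... | inj₂ refl =
  subst (Consecutive ∘ ⋃) (sym (take-all k (Ts ∷ʳ L) (≤-reflexive (length-∷ʳ Ts L)))) cons

PrefixesConsecutive-∷ʳ⁻ : ∀ {Ts : List (Subset n)} {L} →
  PrefixesConsecutive (Ts ∷ʳ L) → PrefixesConsecutive Ts
PrefixesConsecutive-∷ʳ⁻ {Ts = Ts} {L} pc k 1≤k k≤ =
  subst (Consecutive ∘ ⋃) (take-++ˡ k Ts (L ∷ []) k≤)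
    (pc k 1≤k (≤-trans k≤ (subst (length Ts ≤_) (sym (length-∷ʳ Ts L)) (n≤1+n _))))

⋃-take-map-inset : ∀ {c} a r k (Ts : List (Subset c)) →
  ⋃ (take k (List.map (inset a r) Ts)) ≡ inset a r (⋃ (take k Ts))
⋃-take-map-inset a r k Ts = trans (cong ⋃ (take-map k Ts)) (⋃-map-inset a r (take k Ts))

PrefixesConsecutive-map-inset⁺ : ∀ {c} a r {Ts : List (Subset c)} →
  PrefixesConsecutive Ts → PrefixesConsecutive (List.map (inset a r) Ts)
PrefixesConsecutive-map-inset⁺ a r {Ts} pc k 1≤k k≤ =
  subst Consecutive (sym (⋃-take-map-inset a r k Ts))
    (Consecutive-inset⁺ a r (pc k 1≤k (subst (k ≤_) (length-map (inset a r) Ts) k≤)))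

PrefixesConsecutive-map-inset⁻ : ∀ {c} a r {Ts : List (Subset c)} →
  PrefixesConsecutive (List.map (inset a r) Ts) → PrefixesConsecutive Ts
PrefixesConsecutive-map-inset⁻ a r {Ts} pc k 1≤k k≤ =
  Consecutive-inset⁻ a r (subst Consecutive (⋃-take-map-inset a r k Ts)
    (pc k 1≤k (subst (k ≤_) (sym (length-map (inset a r) Ts)) k≤)))

extend : ∀ {c} a r → List (Subset c) → List (Subset (a + (c + r)))
extend {c} a r Ts = List.map (inset a r) Ts ∷ʳ frame a c r

⋃-extend : ∀ {c} a r (Ts : List (Subset c)) → ⋃ (extend a r Ts) ≡ pad inside a r (⋃ Ts)
⋃-extend {c} a r Ts = begin
  ⋃ (List.map (inset a r) Ts ∷ʳ frame a c r)   ≡⟨ ⋃-∷ʳ (List.map (inset a r) Ts) (frame a c r) ⟩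
  ⋃ (List.map (inset a r) Ts) ∪ frame a c r    ≡⟨ cong (_∪ frame a c r) (⋃-map-inset a r Ts) ⟩
  inset a r (⋃ Ts) ∪ frame a c r               ≡⟨ inset-∪-frame a r (⋃ Ts) ⟩
  pad inside a r (⋃ Ts)                        ∎
  where open ≡-Reasoning

⋃-extend≡⊤ : ∀ {c} a r {Ts : List (Subset c)} → ⋃ Ts ≡ ⊤ → ⋃ (extend a r Ts) ≡ ⊤
⋃-extend≡⊤ {c} a r {Ts} cover =
  trans (⋃-extend a r Ts) (trans (cong (pad inside a r) cover) (pad-replicate inside a c r))

⋃-extend≡⊤⁻ : ∀ {c} a r {Ts : List (Subset c)} → ⋃ (extend a r Ts) ≡ ⊤ → ⋃ Ts ≡ ⊤
⋃-extend≡⊤⁻ {c} a r {Ts} cover =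
  pad-injective inside a r (trans (sym (⋃-extend a r Ts)) (trans cover (sym (pad-replicate inside a c r))))

extend-isOrderedPartitionSequence : ∀ {c} a r {Ts : List (Subset c)} → 1 ≤ a + r →
  IsOrderedPartitionSequence Ts → IsOrderedPartitionSequence (extend a r Ts)
extend-isOrderedPartitionSequence {c} a r {Ts} 1≤a+r (_ , nonempty , disjoint , cover) =
    subst (1 ≤_) (sym (length-∷ʳ (List.map (inset a r) Ts) (frame a c r))) (s≤s z≤n)
  , Allₚ.∷ʳ⁺ (Allₚ.map⁺ (All.map (inset-nonempty⁺ a r) nonempty)) (frame-nonempty⁺ a c r 1≤a+r)
  , AllPairs-∷ʳ⁺ (AllPairsₚ.map⁺ (AllPairs.map inset-disjoint disjoint))
                 (Allₚ.map⁺ (All.universal (λ T → subst Empty (sym (inset-∩-frame a r T)) ⊥-empty) Ts))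
  , ⋃-extend≡⊤ a r {Ts} cover
  where
  inset-disjoint : ∀ {S T} → Empty (S ∩ T) → Empty (inset a r S ∩ inset a r T)
  inset-disjoint {S} {T} S∩T≡∅ = subst Empty (sym (inset-∩ a r S T)) (inset-empty⁺ a r S∩T≡∅)

extend-isOrderedPartitionSequence⁻ : ∀ {c} a r {Ts : List (Subset c)} → 1 ≤ length Ts →
  IsOrderedPartitionSequence (extend a r Ts) → IsOrderedPartitionSequence Ts
extend-isOrderedPartitionSequence⁻ a r {Ts} 1≤len (_ , nonempty , disjoint , cover) =
    1≤len
  , All.map (inset-nonempty⁻ a r) (Allₚ.map⁻ (proj₁ (Allₚ.∷ʳ⁻ nonempty)))
  , AllPairs.map inset-disjoint⁻ (AllPairsₚ.map⁻ (proj₁ (AllPairs-∷ʳ⁻ _ disjoint)))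
  , ⋃-extend≡⊤⁻ a r {Ts} cover
  where
  inset-disjoint⁻ : ∀ {S T} → Empty (inset a r S ∩ inset a r T) → Empty (S ∩ T)
  inset-disjoint⁻ {S} {T} e = inset-empty⁻ a r (subst Empty (inset-∩ a r S T) e)

extend-isOrderConsecutive : ∀ {c} a r {Ts : List (Subset c)} → 1 ≤ a + r →
  IsOrderConsecutivePartitionSequence Ts → IsOrderConsecutivePartitionSequence (extend a r Ts)
extend-isOrderConsecutive a r {Ts} 1≤a+r (partition , prefixes) =
    extend-isOrderedPartitionSequence a r 1≤a+r partition
  , PrefixesConsecutive-∷ʳ⁺ (PrefixesConsecutive-map-inset⁺ a r prefixes)
      (subst Consecutive (sym (⋃-extend≡⊤ a r {Ts} (proj₂ (proj₂ (proj₂ partition))))) Consecutive-⊤)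

extend-isOrderConsecutive⁻ : ∀ {c} a r {Ts : List (Subset c)} → 1 ≤ length Ts →
  IsOrderConsecutivePartitionSequence (extend a r Ts) → IsOrderConsecutivePartitionSequence Ts
extend-isOrderConsecutive⁻ a r 1≤len (partition , prefixes) =
    extend-isOrderedPartitionSequence⁻ a r 1≤len partition
  , PrefixesConsecutive-map-inset⁻ a r (PrefixesConsecutive-∷ʳ⁻ prefixes)

record Extension (Ss : List (Subset n)) : Set where
  constructor extension
  field
    left width right : ℕ
    1≤left+right : 1 ≤ left + right
    inner : List (Subset width)
    inner-isOrderConsecutive : IsOrderConsecutivePartitionSequence inner
    size≡ : left + (width + right) ≡ n
    form : subst (List ∘ Subset) size≡ (extend left right inner) ≡ Ss

⋃-nonempty : ∀ {Ts : List (Subset n)} → 1 ≤ length Ts → All Nonempty Ts → Nonempty (⋃ Ts)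
⋃-nonempty {Ts = T ∷ Ts} _ ((i , i∈T) ∷ _) = i , p⊆p∪q (⋃ Ts) i∈T

All-⊆-inset-⊤ : ∀ {c} a r {Ts : List (Subset (a + (c + r)))} → All (_⊆ inset a r ⊤) Ts →
  ∃ λ Ts′ → List.map (inset a r) Ts′ ≡ Ts
All-⊆-inset-⊤ a r []           = [] , refl
All-⊆-inset-⊤ a r (T⊆ ∷ Ts⊆) with ⊆-inset-⊤ a r T⊆ | All-⊆-inset-⊤ a r Ts⊆
... | T′ , refl | Ts′ , refl = T′ ∷ Ts′ , refl

isOrderConsecutive⇒Extension : ∀ {Ts : List (Subset n)} {L} → 1 ≤ length Ts →
  IsOrderConsecutivePartitionSequence (Ts ∷ʳ L) → Extension (Ts ∷ʳ L)
isOrderConsecutive⇒Extension {Ts = Ts} {L} 1≤len oc@((_ , nonempty , disjoint , cover) , prefixes)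
  with Consecutive⇒IntervalForm consecutive (⋃-nonempty 1≤len (proj₁ (Allₚ.∷ʳ⁻ nonempty)))
  where
  consecutive : Consecutive (⋃ Ts)
  consecutive = subst (Consecutive ∘ ⋃) (take-all (length Ts) Ts ≤-refl)
    (PrefixesConsecutive-∷ʳ⁻ {Ts = Ts} {L} prefixes (length Ts) 1≤len ≤-refl)
... | intervalForm a c r refl ⋃Ts≡
  with All-⊆-inset-⊤ a r (All.map (λ T⊆ {i} i∈ → subst (i ∈_) (sym ⋃Ts≡) (T⊆ i∈)) (⊆-⋃ Ts))
...   | Ts′ , refl = extension a c r 1≤a+r Ts′ ocTs′ refl form
  where
  L≡frame : L ≡ frame a c r
  L≡frame = begin
    L
      ≡⟨ ∁-unique (trans (sym (⋃-∷ʳ Ts L)) cover) (⋃-disjoint Ts (proj₂ (AllPairs-∷ʳ⁻ Ts disjoint))) ⟩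
    ∁ (⋃ Ts)        ≡⟨ cong ∁ (sym ⋃Ts≡) ⟩
    ∁ (inset a r ⊤) ≡⟨ ∁-inset-⊤ a c r ⟩
    frame a c r     ∎
    where open ≡-Reasoning
  1≤a+r : 1 ≤ a + r
  1≤a+r = frame-nonempty⁻ a c r (subst Nonempty L≡frame (proj₂ (Allₚ.∷ʳ⁻ nonempty)))
  form : extend a r Ts′ ≡ List.map (inset a r) Ts′ ∷ʳ L
  form = cong (_ ∷ʳ_) (sym L≡frame)
  ocTs′ : IsOrderConsecutivePartitionSequence Ts′
  ocTs′ = extend-isOrderConsecutive⁻ a r (subst (1 ≤_) (length-map (inset a r) Ts′) 1≤len)
            (subst IsOrderConsecutivePartitionSequence (sym form) oc)


-- How an order-consecutive sequence grows from its first set: base s is ([1+s]), growˡ a r appends a set of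
-- 1+a points on the left and r points on the right, growʳ r appends a set of 1+r points on the right only.
data Nesting : Set where
  base  : ℕ → Nesting
  growˡ : ℕ → ℕ → Nesting → Nesting
  growʳ : ℕ → Nesting → Nesting

size : Nesting → ℕ
size (base s)      = suc s
size (growˡ a r ν) = suc a + (size ν + r)
size (growʳ r ν)   = size ν + suc r

subsets : (ν : Nesting) → List (Subset (size ν))
subsets (base s)      = ⊤ ∷ []
subsets (growˡ a r ν) = extend (suc a) r (subsets ν)
subsets (growʳ r ν)   = extend 0 (suc r) (subsets ν)

1≤size : ∀ ν → 1 ≤ size ν
1≤size (base s)      = s≤s z≤n
1≤size (growˡ a r ν) = s≤s z≤n
1≤size (growʳ r ν)   = ≤-trans (1≤size ν) (m≤m+n (size ν) (suc r))

isOrderConsecutive-⊤ : ∀ s → IsOrderConsecutivePartitionSequence (⊤ {suc s} ∷ [])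
isOrderConsecutive-⊤ s = (s≤s z≤n , (zero , here) ∷ [] , [] ∷ [] , ∪-identityʳ ⊤) , prefixes
  where
  prefixes : PrefixesConsecutive (⊤ {suc s} ∷ [])
  prefixes 1 _ _ = subst Consecutive (sym (∪-identityʳ ⊤)) Consecutive-⊤
  prefixes (suc (suc _)) _ (s≤s ())

subsets-isOrderConsecutive : ∀ ν → IsOrderConsecutivePartitionSequence (subsets ν)
subsets-isOrderConsecutive (base s)      = isOrderConsecutive-⊤ s
subsets-isOrderConsecutive (growˡ a r ν) =
  extend-isOrderConsecutive (suc a) r (s≤s z≤n) (subsets-isOrderConsecutive ν)
subsets-isOrderConsecutive (growʳ r ν)   =
  extend-isOrderConsecutive 0 (suc r) (s≤s z≤n) (subsets-isOrderConsecutive ν)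

-- Nestings of different sizes have subsets of different types, so subsets are compared through toList.
padList : A → ℕ → ℕ → List A → List A
padList x a r xs = List.replicate a x List.++ (xs List.++ List.replicate r x)

toList-pad : ∀ {c} (x : A) a r (xs : Vec A c) → toList (pad x a r xs) ≡ padList x a r (toList xs)
toList-pad x a r xs =
  trans (toList-++ (Vec.replicate a x) _)
    (cong₂ List._++_ (toList-replicate a x)
      (trans (toList-++ xs _) (cong (toList xs List.++_) (toList-replicate r x))))

padList-injective : ∀ (x : A) a r {xs ys} → padList x a r xs ≡ padList x a r ys → xs ≡ ys
padList-injective x a r {xs} {ys} eq =
  ++-cancelʳ (List.replicate r x) xs ys (++-cancelˡ (List.replicate a x) _ _ eq)

replicate-injective : ∀ {x : A} m n → List.replicate m x ≡ List.replicate n x → m ≡ n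
replicate-injective m n eq = trans (sym (length-replicate m)) (trans (cong length eq) (length-replicate n))

padList-frame-injective : ∀ a c r a′ c′ r′ → 1 ≤ c → 1 ≤ c′ →
  padList inside a r (List.replicate c outside) ≡ padList inside a′ r′ (List.replicate c′ outside) →
  a ≡ a′ × c ≡ c′ × r ≡ r′
padList-frame-injective (suc a) c r (suc a′) c′ r′ 1≤c 1≤c′ eq
  with refl , eqs ← padList-frame-injective a c r a′ c′ r′ 1≤c 1≤c′ (proj₂ (∷-injective eq))
  = refl , eqs
padList-frame-injective zero (suc c) r (suc a′) c′ r′ _ _ ()
padList-frame-injective (suc a) c r zero (suc c′) r′ _ _ ()
padList-frame-injective zero c r zero c′ r′ _ _ eq = refl , middle c r c′ r′ eq
  where
  middle : ∀ c r c′ r′ →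
    List.replicate c outside List.++ List.replicate r inside ≡
    List.replicate c′ outside List.++ List.replicate r′ inside →
    c ≡ c′ × r ≡ r′
  middle zero    r       zero     r′       eq = refl , replicate-injective r r′ eq
  middle (suc c) r       (suc c′) r′       eq
    with refl , eq′ ← middle c r c′ r′ (proj₂ (∷-injective eq)) = refl , eq′
  middle zero    zero    (suc c′) r′       ()
  middle zero    (suc r) (suc c′) r′       ()
  middle (suc c) r       zero     zero     ()
  middle (suc c) r       zero     (suc r′) ()

toList-extend : ∀ {c} a r (Ts : List (Subset c)) →
  List.map toList (extend a r Ts) ≡
  List.map (padList outside a r) (List.map toList Ts) ∷ʳ padList inside a r (List.replicate c outside)
toList-extend {c} a r Ts = begin
  List.map toList (List.map (inset a r) Ts ∷ʳ frame a c r)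
    ≡⟨ Listₚ.map-++ toList (List.map (inset a r) Ts) _ ⟩
  List.map toList (List.map (inset a r) Ts) ∷ʳ toList (frame a c r)
    ≡⟨ cong₂ _∷ʳ_ (trans (sym (map-∘ Ts)) (trans (map-cong (toList-pad outside a r) Ts) (map-∘ Ts)))
                  (trans (toList-pad inside a r ⊥) (cong (padList inside a r) (toList-replicate c outside))) ⟩
  List.map (padList outside a r) (List.map toList Ts) ∷ʳ padList inside a r (List.replicate c outside) ∎
  where open ≡-Reasoning

extend-toList-injective : ∀ {c c′} a r a′ r′ {Ts : List (Subset c)} {Ts′ : List (Subset c′)} →
  1 ≤ c → 1 ≤ c′ →
  List.map toList (extend a r Ts) ≡ List.map toList (extend a′ r′ Ts′) →
  a ≡ a′ × r ≡ r′ × List.map toList Ts ≡ List.map toList Ts′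
extend-toList-injective {c} {c′} a r a′ r′ {Ts} {Ts′} 1≤c 1≤c′ eq
  with insets , frames ←
         ∷ʳ-injective _ _ (trans (sym (toList-extend a r Ts)) (trans eq (toList-extend a′ r′ Ts′)))
  with refl , _ , refl ← padList-frame-injective a c r a′ c′ r′ 1≤c 1≤c′ frames
  = refl , refl , map-injective (padList-injective outside a r) insets

length-subsets : ∀ ν → 1 ≤ length (subsets ν)
length-subsets ν = proj₁ (proj₁ (subsets-isOrderConsecutive ν))

base≢extend : ∀ s {c} a r {Ts : List (Subset c)} → 1 ≤ length Ts →
  List.map toList (⊤ {suc s} ∷ []) ≢ List.map toList (extend a r Ts)
base≢extend s a r {_ ∷ Ts} _ eq =
  0≢1+n (trans (cong length (proj₂ (∷-injective eq)))
                (trans (length-map toList (extend a r Ts)) (length-∷ʳ (List.map (inset a r) Ts) _)))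

subsets-injective : ∀ ν ν′ →
  List.map toList (subsets ν) ≡ List.map toList (subsets ν′) → ν ≡ ν′
subsets-injective (base s) (base s′) eq =
  cong base (suc-injective (trans (sym (length-toList (⊤ {suc s})))
    (trans (cong length (proj₁ (∷-injective eq))) (length-toList (⊤ {suc s′})))))
subsets-injective (base s) (growˡ a r ν) eq = contradiction eq (base≢extend s (suc a) r (length-subsets ν))
subsets-injective (base s) (growʳ r ν)   eq = contradiction eq (base≢extend s 0 (suc r) (length-subsets ν))
subsets-injective (growˡ a r ν) (base s) eq =
  contradiction (sym eq) (base≢extend s (suc a) r (length-subsets ν))
subsets-injective (growʳ r ν)   (base s) eq =
  contradiction (sym eq) (base≢extend s 0 (suc r) (length-subsets ν))
subsets-injective (growˡ a r ν) (growˡ a′ r′ ν′) eq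
  with refl , refl , eq′ ← extend-toList-injective (suc a) r (suc a′) r′ (1≤size ν) (1≤size ν′) eq
  = cong (growˡ a r) (subsets-injective ν ν′ eq′)
subsets-injective (growʳ r ν) (growʳ r′ ν′) eq
  with refl , refl , eq′ ← extend-toList-injective 0 (suc r) 0 (suc r′) (1≤size ν) (1≤size ν′) eq
  = cong (growʳ r) (subsets-injective ν ν′ eq′)
subsets-injective (growˡ a r ν) (growʳ r′ ν′) eq
  with () ← proj₁ (extend-toList-injective (suc a) r 0 (suc r′) (1≤size ν) (1≤size ν′) eq)
subsets-injective (growʳ r ν) (growˡ a′ r′ ν′) eq
  with () ← proj₁ (extend-toList-injective 0 (suc r) (suc a′) r′ (1≤size ν) (1≤size ν′) eq)

NestingOfSize : ℕ → Set
NestingOfSize n = Σ Nesting λ ν → size ν ≡ n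

subsetsOf : ∀ {n} → NestingOfSize n → List (Subset n)
subsetsOf (ν , size≡) = subst (List ∘ Subset) size≡ (subsets ν)

grow : ∀ a r → 1 ≤ a + r → ∀ ν →
  ∃ λ (ν′ : NestingOfSize _) → subsetsOf ν′ ≡ extend a r (subsets ν)
grow zero    (suc r) _ ν = (growʳ r ν , refl) , refl
grow (suc a) r       _ ν = (growˡ a r ν , refl) , refl

length-extend : ∀ {c} a r (Ts : List (Subset c)) → length (extend a r Ts) ≡ suc (length Ts)
length-extend a r Ts = trans (length-∷ʳ (List.map (inset a r) Ts) _) (cong suc (length-map (inset a r) Ts))

isOrderConsecutive⇒subsets : ∀ {n} (Ss : List (Subset n)) →
  IsOrderConsecutivePartitionSequence Ss → ∃ λ (ν : NestingOfSize n) → subsetsOf ν ≡ Ss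
isOrderConsecutive⇒subsets []       ((() , _) , _)
isOrderConsecutive⇒subsets (S ∷ Ss) oc = go (length Ss) (S ∷ Ss) refl oc
  where
  1≤length-init : ∀ (xs : List A) {x p} → length (xs ∷ʳ x) ≡ suc (suc p) → 1 ≤ length xs
  1≤length-init []      ()
  1≤length-init (_ ∷ _) _ = s≤s z≤n

  go : ∀ p {n} (Ss : List (Subset n)) → length Ss ≡ suc p →
    IsOrderConsecutivePartitionSequence Ss → ∃ λ (ν : NestingOfSize n) → subsetsOf ν ≡ Ss
  go zero {zero}  (S ∷ []) _ ((_ , (() , _) ∷ _ , _) , _)
  go zero {suc s} (S ∷ []) _ ((_ , _ , _ , cover) , _) =
    (base s , refl) , cong (_∷ []) (sym (trans (sym (∪-identityʳ S)) cover))
  go (suc p) Ss len oc with List.initLast Ss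
  ... | Ts List.∷ʳ′ L
    with extension a c r 1≤a+r Ts′ ocTs′ refl form ←
           isOrderConsecutive⇒Extension (1≤length-init Ts len) oc
    with (ν , refl) , refl ←
           go p Ts′ (suc-injective (trans (sym (length-extend a r Ts′)) (trans (cong length form) len))) ocTs′
    with ν′ , subsets≡ ← grow a r 1≤a+r ν
    = ν′ , trans subsets≡ form

≡-NestingOfSize : ∀ {n} {ν ν′ : NestingOfSize n} → proj₁ ν ≡ proj₁ ν′ → ν ≡ ν′
≡-NestingOfSize {ν = ν , e} {.ν , e′} refl = cong (ν ,_) (≡-irrelevant e e′)

subsetsOf-isOrderConsecutive : ∀ {n} (ν : NestingOfSize n) →
  IsOrderConsecutivePartitionSequence (subsetsOf ν)
subsetsOf-isOrderConsecutive (ν , refl) = subsets-isOrderConsecutive ν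

subsetsOf-injective : ∀ {n} → Injective _≡_ _≡_ (subsetsOf {n})
subsetsOf-injective {x = ν , e} {ν′ , e′} eq =
  ≡-NestingOfSize (subsets-injective ν ν′
    (trans (sym (toList-subst e)) (trans (cong (List.map toList) eq) (toList-subst e′))))
  where
  toList-subst : ∀ {m n} (e : m ≡ n) {Ts : List (Subset m)} →
    List.map toList (subst (List ∘ Subset) e Ts) ≡ List.map toList Ts
  toList-subst refl = refl

-- Blocks and odd-indexed Fibonacci numbers

[,]-splitAt-injective : ∀ {B : Set} m {n} {f : Fin m → B} {g : Fin n → B} →
  Injective _≡_ _≡_ f → Injective _≡_ _≡_ g → (∀ i j → f i ≢ g j) →
  Injective _≡_ _≡_ ([ f , g ]′ ∘ splitAt m)
[,]-splitAt-injective m {n} {f} {g} f-inj g-inj f≢g {i} {j} eq =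
  trans (sym (join-splitAt m n i))
    (trans (cong (join m n) (sum-injective (splitAt m i) (splitAt m j) eq)) (join-splitAt m n j))
  where
  sum-injective : ∀ x y → [ f , g ]′ x ≡ [ f , g ]′ y → x ≡ y
  sum-injective (inj₁ x) (inj₁ y) eq = cong inj₁ (f-inj eq)
  sum-injective (inj₁ x) (inj₂ y) eq = contradiction eq (f≢g x y)
  sum-injective (inj₂ x) (inj₁ y) eq = contradiction (sym eq) (f≢g y x)
  sum-injective (inj₂ x) (inj₂ y) eq = cong inj₂ (g-inj eq)

double : ℕ → ℕ
double zero    = zero
double (suc k) = suc (suc (double k))

fibOddWeight-suc : ∀ k → fibOddWeight (suc k) ≡ fib (suc (double k))
fibOddWeight-suc k = cong (λ m → fib (m ∸ 1)) (2*≡double (suc k))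
  where
  2*≡double : ∀ k → 2 * k ≡ double k
  2*≡double zero    = refl
  2*≡double (suc k) = trans (*-suc 2 k) (cong (λ m → suc (suc m)) (2*≡double k))

-- A block is a run of growˡ steps ending at a first interval or at a growʳ step, either one written end s.
data Block : Set where
  end   : ℕ → Block
  growˡ : ℕ → ℕ → Block → Block

blockSize : Block → ℕ
blockSize (end s)       = suc s
blockSize (growˡ a r b) = suc a + (blockSize b + r)

growˡ₀ : ℕ × Block → Block
growˡ₀ (a , b) = growˡ a 0 b

widen : Block → Block
widen (end s)       = end (suc s)
widen (growˡ a r b) = growˡ a (suc r) b

blockSize-widen : ∀ b → blockSize (widen b) ≡ suc (blockSize b)
blockSize-widen (end s)       = refl
blockSize-widen (growˡ a r b) = cong suc (trans (cong (a +_) (+-suc (blockSize b) r)) (+-suc a _))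

-- block k lists the blocks of size 1+k, block₀ k the pairs (a , b) for which growˡ₀ (a , b) has size 1+k.
block  : ∀ k → Fin (fib (suc (double k))) → Block
block₀ : ∀ k → Fin (fib (double k)) → ℕ × Block
block zero    zero = end 0
block (suc k) i    = [ growˡ₀ ∘ block₀ (suc k) , widen ∘ block k ]′ (splitAt (fib (double (suc k))) i)
block₀ (suc k) i   = [ (0 ,_) ∘ block k , map₁ suc ∘ block₀ k ]′ (splitAt (fib (suc (double k))) i)

[,]-∀ : ∀ {A B C : Set} (P : C → Set) {f : A → C} {g : B → C} →
  (∀ x → P (f x)) → (∀ y → P (g y)) → ∀ s → P ([ f , g ]′ s)
[,]-∀ P p q (inj₁ x) = p x
[,]-∀ P p q (inj₂ y) = q y

blockSize-block  : ∀ k i → blockSize (block k i) ≡ suc k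
blockSize-block₀ : ∀ k j → blockSize (growˡ₀ (block₀ k j)) ≡ suc k
blockSize-block zero    zero = refl
blockSize-block (suc k) i    =
  [,]-∀ (λ b → blockSize b ≡ suc (suc k))
    (blockSize-block₀ (suc k))
    (λ j → trans (blockSize-widen (block k j)) (cong suc (blockSize-block k j)))
    (splitAt (fib (double (suc k))) i)
blockSize-block₀ (suc k) j   =
  [,]-∀ (λ p → blockSize (growˡ₀ p) ≡ suc (suc k))
    (λ i → cong suc (trans (+-identityʳ _) (blockSize-block k i)))
    (λ i → cong suc (blockSize-block₀ k i))
    (splitAt (fib (suc (double k))) j)

growˡ₀-injective : Injective _≡_ _≡_ growˡ₀
growˡ₀-injective refl = refl

widen-injective : Injective _≡_ _≡_ widen
widen-injective {end _}       {end _}       refl = refl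
widen-injective {growˡ _ _ _} {growˡ _ _ _} refl = refl

growˡ₀≢widen : ∀ p b → growˡ₀ p ≢ widen b
growˡ₀≢widen _ (end _)       ()
growˡ₀≢widen _ (growˡ _ _ _) ()

block-injective  : ∀ k → Injective _≡_ _≡_ (block k)
block₀-injective : ∀ k → Injective _≡_ _≡_ (block₀ k)
block-injective zero {zero} {zero} _ = refl
block-injective (suc k) =
  [,]-splitAt-injective (fib (double (suc k)))
    (block₀-injective (suc k) ∘ growˡ₀-injective) (block-injective k ∘ widen-injective)
    (λ i j → growˡ₀≢widen (block₀ (suc k) i) (block k j))
block₀-injective (suc k) =
  [,]-splitAt-injective (fib (suc (double k)))
    (block-injective k ∘ cong proj₂) (block₀-injective k ∘ suc-pair-injective)
    (λ _ _ ())
  where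
  suc-pair-injective : ∀ {p q : ℕ × Block} → map₁ suc p ≡ map₁ suc q → p ≡ q
  suc-pair-injective refl = refl

block-↑ˡ : ∀ k j → block (suc k) (j ↑ˡ fib (suc (double k))) ≡ growˡ₀ (block₀ (suc k) j)
block-↑ˡ k j rewrite splitAt-↑ˡ (fib (double (suc k))) j (fib (suc (double k))) = refl

block-↑ʳ : ∀ k i → block (suc k) (fib (double (suc k)) ↑ʳ i) ≡ widen (block k i)
block-↑ʳ k i rewrite splitAt-↑ʳ (fib (double (suc k))) (fib (suc (double k))) i = refl

block₀-↑ˡ : ∀ k i → block₀ (suc k) (i ↑ˡ fib (double k)) ≡ (0 , block k i)
block₀-↑ˡ k i rewrite splitAt-↑ˡ (fib (suc (double k))) i (fib (double k)) = refl

block₀-↑ʳ : ∀ k j → block₀ (suc k) (fib (suc (double k)) ↑ʳ j) ≡ map₁ suc (block₀ k j)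
block₀-↑ʳ k j rewrite splitAt-↑ʳ (fib (suc (double k))) (fib (double k)) j = refl

blockSize-growˡ₀ : ∀ {a b n} → blockSize (growˡ a 0 b) ≡ n → suc a + blockSize b ≡ n
blockSize-growˡ₀ {a} {b} = trans (cong (suc a +_) (sym (+-identityʳ (blockSize b))))

block-surjective  : ∀ k b → blockSize b ≡ suc k → ∃ λ i → block k i ≡ b
block₀-surjective : ∀ k a b → suc a + blockSize b ≡ suc k → ∃ λ j → block₀ k j ≡ (a , b)
block-surjective zero    (end zero)       refl = zero , refl
block-surjective (suc k) (end (suc .k))   refl with i , eq ← block-surjective k (end k) refl =
  fib (double (suc k)) ↑ʳ i , trans (block-↑ʳ k i) (cong widen eq)
block-surjective zero    (end (suc _))    ()
block-surjective (suc k) (end zero)       ()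
block-surjective zero    (growˡ a zero b) size≡
  with () , _ ← block₀-surjective zero a b (blockSize-growˡ₀ {a} {b} size≡)
block-surjective (suc k) (growˡ a zero b) size≡
  with j , eq ← block₀-surjective (suc k) a b (blockSize-growˡ₀ {a} {b} size≡) =
  j ↑ˡ _ , trans (block-↑ˡ k j) (cong growˡ₀ eq)
block-surjective (suc k) (growˡ a (suc r) b) size≡
  with i , eq ← block-surjective k (growˡ a r b)
                  (suc-injective (trans (sym (blockSize-widen (growˡ a r b))) size≡)) =
  fib (double (suc k)) ↑ʳ i , trans (block-↑ʳ k i) (cong widen eq)
block-surjective zero    (growˡ a (suc r) b) size≡
  with () ← trans (sym (blockSize-widen (growˡ a r b))) size≡
block₀-surjective (suc k) zero    b size≡ with i , eq ← block-surjective k b (suc-injective size≡) =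
  i ↑ˡ fib (double k) , trans (block₀-↑ˡ k i) (cong (0 ,_) eq)
block₀-surjective (suc k) (suc a) b size≡ with j , eq ← block₀-surjective k a b (suc-injective size≡) =
  fib (suc (double k)) ↑ʳ j , trans (block₀-↑ʳ k j) (cong (map₁ suc) eq)
block₀-surjective zero    (suc a) b ()
block₀-surjective zero    zero    (end _)       ()
block₀-surjective zero    zero    (growˡ _ _ _) ()

cast-injective : ∀ {m n} (eq : m ≡ n) → Injective _≡_ _≡_ (cast eq)
cast-injective eq {i} {j} cast≡ =
  trans (sym (cast-involutive (sym eq) eq i))
    (trans (cong (cast (sym eq)) cast≡) (cast-involutive (sym eq) eq j))

toBlock : ColoredPart fibOddWeight → Block
toBlock (suc k , _ , c) = block k (cast (fibOddWeight-suc k) c)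

blockSize-toBlock : ∀ p → blockSize (toBlock p) ≡ partSize p
blockSize-toBlock (suc k , _ , c) = blockSize-block k _

toBlock-injective : Injective _≡_ _≡_ toBlock
toBlock-injective {suc k , s≤s z≤n , c} {suc k′ , s≤s z≤n , c′} eq
  with refl ← trans (sym (blockSize-block k _)) (trans (cong blockSize eq) (blockSize-block k′ _))
  with refl ← cast-injective (fibOddWeight-suc k) (block-injective k eq) = refl

blockSize-suc : ∀ b → ∃ λ k → blockSize b ≡ suc k
blockSize-suc (end s)       = s , refl
blockSize-suc (growˡ a r b) = a + (blockSize b + r) , refl

toBlock-surjective : ∀ b → ∃ λ p → toBlock p ≡ b
toBlock-surjective b with k , size≡ ← blockSize-suc b with i , eq ← block-surjective k b size≡ =
  (suc k , s≤s z≤n , cast (sym (fibOddWeight-suc k)) i) ,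
  trans (cong (block k) (cast-involutive (fibOddWeight-suc k) (sym (fibOddWeight-suc k)) i)) eq

-- Compositions as sequences of blocks

plug : Block → (ℕ → Nesting) → Nesting
plug (end s)       k = k s
plug (growˡ a r b) k = growˡ a r (plug b k)

fromBlocks : Block → List Block → Nesting
fromBlocks b []        = plug b base
fromBlocks b (b′ ∷ bs) = plug b λ s → growʳ s (fromBlocks b′ bs)

toBlocks : Nesting → Block × List Block
toBlocks (base s)      = end s , []
toBlocks (growʳ s ν)   = end s , uncurry _∷_ (toBlocks ν)
toBlocks (growˡ a r ν) = map₁ (growˡ a r) (toBlocks ν)

toBlocks-plug : ∀ b {k bs} → (∀ s → toBlocks (k s) ≡ (end s , bs)) → toBlocks (plug b k) ≡ (b , bs)
toBlocks-plug (end s)       h = h s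
toBlocks-plug (growˡ a r b) h = cong (map₁ (growˡ a r)) (toBlocks-plug b h)

toBlocks-fromBlocks : ∀ b bs → toBlocks (fromBlocks b bs) ≡ (b , bs)
toBlocks-fromBlocks b []        = toBlocks-plug b λ _ → refl
toBlocks-fromBlocks b (b′ ∷ bs) =
  toBlocks-plug b λ s → cong (λ p → end s , uncurry _∷_ p) (toBlocks-fromBlocks b′ bs)

fromBlocks-growˡ : ∀ a r b bs → fromBlocks (growˡ a r b) bs ≡ growˡ a r (fromBlocks b bs)
fromBlocks-growˡ a r b []      = refl
fromBlocks-growˡ a r b (_ ∷ _) = refl

fromBlocks-toBlocks : ∀ ν → uncurry fromBlocks (toBlocks ν) ≡ ν
fromBlocks-toBlocks (base s)      = refl
fromBlocks-toBlocks (growʳ s ν)   = cong (growʳ s) (fromBlocks-toBlocks ν)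
fromBlocks-toBlocks (growˡ a r ν) =
  trans (fromBlocks-growˡ a r _ (proj₂ (toBlocks ν))) (cong (growˡ a r) (fromBlocks-toBlocks ν))

size-plug : ∀ b {k} m → (∀ s → size (k s) ≡ m + suc s) → size (plug b k) ≡ m + blockSize b
size-plug (end s)       m h = h s
size-plug (growˡ a r b) m h =
  trans (cong (λ x → suc a + (x + r)) (size-plug b m h)) (rearrange m a (blockSize b) r)
  where
  rearrange : ∀ m a x r → suc a + ((m + x) + r) ≡ m + (suc a + (x + r))
  rearrange = solve-∀

size-fromBlocks : ∀ b bs → size (fromBlocks b bs) ≡ sum (List.map blockSize (b ∷ bs))
size-fromBlocks b []        = trans (size-plug b 0 λ _ → refl) (+-comm 0 (blockSize b))
size-fromBlocks b (b′ ∷ bs) =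
  trans (size-plug b _ λ _ → refl)
    (trans (+-comm _ (blockSize b)) (cong (blockSize b +_) (size-fromBlocks b′ bs)))

map-toBlock-surjective : ∀ bs → ∃ λ ps → List.map toBlock ps ≡ bs
map-toBlock-surjective []       = [] , refl
map-toBlock-surjective (b ∷ bs)
  with p , refl ← toBlock-surjective b | ps , refl ← map-toBlock-surjective bs = p ∷ ps , refl

size-fromBlocks-toBlock : ∀ p ps →
  size (fromBlocks (toBlock p) (List.map toBlock ps)) ≡ sum (List.map partSize (p ∷ ps))
size-fromBlocks-toBlock p ps =
  trans (size-fromBlocks (toBlock p) (List.map toBlock ps))
        (cong sum (trans (sym (map-∘ (p ∷ ps))) (map-cong blockSize-toBlock (p ∷ ps))))

toNesting : ∀ {n} → 1 ≤ n → ColoredComposition fibOddWeight n → NestingOfSize n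
toNesting ()  ([] , refl)
toNesting _   (p ∷ ps , sum≡) =
  fromBlocks (toBlock p) (List.map toBlock ps) , trans (size-fromBlocks-toBlock p ps) sum≡

toNesting-injective : ∀ {n} (1≤n : 1 ≤ n) → Injective _≡_ _≡_ (toNesting 1≤n)
toNesting-injective () {[] , refl}
toNesting-injective () {_ ∷ _ , _} {[] , refl}
toNesting-injective _ {p ∷ ps , sum≡} {q ∷ qs , sum≡′} eq with parts≡
  where
  blocks≡ : (toBlock p , List.map toBlock ps) ≡ (toBlock q , List.map toBlock qs)
  blocks≡ =
    trans (sym (toBlocks-fromBlocks _ _)) (trans (cong (toBlocks ∘ proj₁) eq) (toBlocks-fromBlocks _ _))
  parts≡ : p ≡ q × ps ≡ qs
  parts≡ = toBlock-injective (cong proj₁ blocks≡) , map-injective toBlock-injective (cong proj₂ blocks≡)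
... | refl , refl = cong (p ∷ ps ,_) (≡-irrelevant sum≡ sum≡′)

toNesting-surjective : ∀ {n} (1≤n : 1 ≤ n) (ν : NestingOfSize n) → ∃ λ c → toNesting 1≤n c ≡ ν
toNesting-surjective 1≤n (ν , size≡)
  with p , p↦b ← toBlock-surjective (proj₁ (toBlocks ν))
     | ps , ps↦bs ← map-toBlock-surjective (proj₂ (toBlocks ν))
  = (p ∷ ps , trans (sym (size-fromBlocks-toBlock p ps)) (trans (cong size fromBlocks≡ν) size≡)) ,
    ≡-NestingOfSize fromBlocks≡ν
  where
  fromBlocks≡ν : fromBlocks (toBlock p) (List.map toBlock ps) ≡ ν
  fromBlocks≡ν = trans (cong₂ fromBlocks p↦b ps↦bs) (fromBlocks-toBlocks ν)

theorem5p6 : (n : ℕ) → 1 ≤ n →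
    Σ (ColoredComposition fibOddWeight n → List (Subset n)) λ f →
      ((c : ColoredComposition fibOddWeight n) → IsOrderConsecutivePartitionSequence (f c)) ×
      Injective _≡_ _≡_ f ×
      ((Ss : List (Subset n)) → IsOrderConsecutivePartitionSequence Ss →
        ∃ λ c → f c ≡ Ss)
theorem5p6 n 1≤n =
    (λ c → subsetsOf (toNesting 1≤n c))
  , (λ c → subsetsOf-isOrderConsecutive (toNesting 1≤n c))
  , (λ eq → toNesting-injective 1≤n (subsetsOf-injective eq))
  , surjective
  where
  surjective : ∀ Ss → IsOrderConsecutivePartitionSequence Ss →
    ∃ λ c → subsetsOf (toNesting 1≤n c) ≡ Ss
  surjective Ss oc
    with ν , ν↦Ss ← isOrderConsecutive⇒subsets Ss oc
    with c , c↦ν  ← toNesting-surjective 1≤n ν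
    = c , trans (cong subsetsOf c↦ν) ν↦Ss
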